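{- Let $M=(f,G,Z,\mathrm{id})$ be an edge-transitive map. Then the parallel product $N$ of the four simply re-rooted maps $(f,G,Z,\mathrm{id}\cdot W)$, $W\in\{1,T,L,TL\}$, is a reflexible map with $\mathrm{Mon}(N)$ congruent to $\mathrm{Mon}(M)$, and $N$ is the smallest reflexible cover of $M$: it covers $M$ and every reflexible cover of $M$ is a cover of $N$.
   Context: Let $F=\langle t,l,r\mid t^2=l^2=r^2=(tl)^2=1\rangle$. A (finite rooted) map is a quadruple $M=(f,G,Z,\mathrm{id})$, where $Z$ is a finite set of flags, $G=\mathrm{Mon}(M)$ is a group acting on $Z$ on the right, transitively and faithfully, $f:F\to G$ is an epimorphism, and $\mathrm{id}\in Z$ is the root; $T=f(t),L=f(l),R=f(r)$. Two groups with generators labelled $T,L,R$ are congruent if some isomorphism maps each labelled generator to the one with the same label. A morphism $(\phi,\psi):M\to N$ is a group epimorphism $\psi:\mathrm{Mon}(M)\to\mathrm{Mon}(N)$ with $\psi\circ f_M=f_N$ and a surjection $\phi$ of flags with $\phi(\mathrm{id}_M)=\mathrm{id}_N$, $\phi(z\cdot g)=\phi(z)\cdot\psi(g)$; then $M$ is a cover of $N$. An automorphism of $M$ is a bijection $\alpha:Z\to Z$ with $\alpha(z\cdot g)=\alpha(z)\cdot g$; $M$ is reflexible if $\mathrm{Aut}(M)$ acts regularly on $Z$. The edges of $M$ are the orbits of $\langle T,L\rangle$ on $Z$; $M$ is edge-transitive if $\mathrm{Aut}(M)$ acts transitively on the edges. Parallel product: $M_1\parallel M_2=(f_{1,2},K,X,(\mathrm{id}_1,\mathrm{id}_2))$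 with $f_{1,2}=(f_1,f_2)$, $K=f_{1,2}(F)$, $X$ the $K$-orbit of $(\mathrm{id}_1,\mathrm{id}_2)$ in $Z_1\times Z_2$ (associative and commutative up to isomorphism). -}

module Defs where

open import Level using (0ℓ)
open import Data.List using (List; []; _∷_; _++_; [_]; reverse)
open import Data.List.Properties using (unfold-reverse)
open import Data.Product using (Σ; ∃; _×_; _,_; proj₁; proj₂)
open import Relation.Binary.Bundles using (Setoid)
open import Relation.Binary.PropositionalEquality as P using (_≡_)
open import Algebra.Bundles.Raw using (RawGroup)
open import Algebra.Morphism.Structures using (module GroupMorphisms)
import Function.Definitions as FD

-- The group F = < t , l , r | t² = l² = r² = (tl)² = 1 >.
-- Since all generators are involutions, every element of F is the image
-- of a word in the letters t, l, r; we represent elements of F by such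
-- words (the relations are imposed in every monodromy group below).

data Gen : Set where
  t l r : Gen

Word : Set
Word = List Gen

-- words in the letters t, l only: these represent the subgroup <t , l>
data EdgeGen : Set where
  et el : EdgeGen

embE : EdgeGen → Gen
embE et = t
embE el = l

EdgeWord : Set
EdgeWord = List EdgeGen

embW : EdgeWord → Word
embW []      = []
embW (g ∷ w) = embE g ∷ embW w

act : {A : Set} → (Gen → A → A) → A → Word → A
act gen z []      = z
act gen z (g ∷ w) = act gen (gen g z) w

act-++ : {A : Set} (gen : Gen → A → A) (z : A) (u v : Word) →
         act gen z (u ++ v) ≡ act gen (act gen z u) v
act-++ gen z []      v = P.refl
act-++ gen z (g ∷ u) v = act-++ gen (gen g z) u v

-- The flag set Z is a setoid (flags up to the relation _≈_), so
-- that orbits in Z₁ × Z₂ (parallel products) can be formed without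
-- quotient types.  The monodromy group Mon(M) acts faithfully on Z, so
-- it is (up to a labelled isomorphism) the permutation group of Z
-- generated by T = f(t), L = f(l), R = f(r); the epimorphism f sends a
-- word to the permutation it induces.

record Map : Set₁ where
  field
    Flags : Setoid 0ℓ 0ℓ
  open Setoid Flags public renaming (Carrier to Flag)
  field
    gen      : Gen → Flag → Flag
    gen-cong : ∀ g {x y} → x ≈ y → gen g x ≈ gen g y
    T²       : ∀ z → gen t (gen t z) ≈ z
    L²       : ∀ z → gen l (gen l z) ≈ z
    R²       : ∀ z → gen r (gen r z) ≈ z
    TL²      : ∀ z → gen l (gen t (gen l (gen t z))) ≈ z
    root     : Flag
    transitive : ∀ z → ∃ λ (w : Word) → act gen root w ≈ z

open import Data.Nat using (ℕ)
open import Data.Fin using (Fin)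

record IsFinite (M : Map) : Set where
  open Map M
  field
    size    : ℕ
    to      : Flag → Fin size
    from    : Fin size → Flag
    to-cong : ∀ {x y} → x ≈ y → to x ≡ to y
    from-to : ∀ z → from (to z) ≈ z
    to-from : ∀ i → to (from i) ≡ i

module _ (M : Map) where
  open Map M

  _·_ : Flag → Word → Flag
  z · w = act gen z w

  act-cong : ∀ {x y} (w : Word) → x ≈ y → x · w ≈ y · w
  act-cong []      e = e
  act-cong (g ∷ w) e = act-cong w (gen-cong g e)

  gen-inv : ∀ g z → gen g (gen g z) ≈ z
  gen-inv t = T²
  gen-inv l = L²
  gen-inv r = R²

  act-reverse : ∀ z (w : Word) → (z · w) · reverse w ≈ z
  act-reverse z []      = refl
  act-reverse z (g ∷ w) rewrite unfold-reverse g w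
                              | act-++ gen (act gen (gen g z) w) (reverse w) [ g ] =
    trans (gen-cong g (act-reverse (gen g z) w)) (gen-inv g z)

  -- Mon(M): elements f(w) for words w; f(w) = f(w') iff they act equally.
  _≈ᴹ_ : Word → Word → Set
  w ≈ᴹ w' = ∀ z → z · w ≈ z · w'

  Mon : RawGroup 0ℓ 0ℓ
  Mon = record
    { Carrier = Word
    ; _≈_     = _≈ᴹ_
    ; _∙_     = _++_
    ; ε       = []
    ; _⁻¹     = reverse       -- generators are involutions
    }

  record Automorphism : Set where
    field
      α         : Flag → Flag
      α-cong    : ∀ {x y} → x ≈ y → α x ≈ α y
      injective : ∀ {x y} → α x ≈ α y → x ≈ y
      surjective : ∀ y → ∃ λ x → α x ≈ y
      commute   : ∀ z (w : Word) → α (z · w) ≈ α z · w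

  IsReflexible : Set
  IsReflexible =
    (∀ z z' → ∃ λ (a : Automorphism) → Automorphism.α a z ≈ z') ×
    (∀ (a : Automorphism) z → Automorphism.α a z ≈ z →
       ∀ x → Automorphism.α a x ≈ x)

  -- Edges: orbits of <T , L>.  z and z' lie on the same edge.
  SameEdge : Flag → Flag → Set
  SameEdge z z' = ∃ λ (w : EdgeWord) → z · embW w ≈ z'

  IsEdgeTransitive : Set
  IsEdgeTransitive =
    ∀ z z' → ∃ λ (a : Automorphism) → SameEdge (Automorphism.α a z) z'

  reroot : Flag → Map
  reroot z = record
    { Flags = Flags ; gen = gen ; gen-cong = gen-cong
    ; T² = T² ; L² = L² ; R² = R² ; TL² = TL²
    ; root = z
    ; transitive = λ y →
        let (wz , ez) = transitive z
            (wy , ey) = transitive y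
        in reverse wz ++ wy ,
           trans (P.subst (_≈ act gen z (reverse wz) · wy)
                          (P.sym (act-++ gen z (reverse wz) wy)) refl)
           (trans (act-cong wy (act-cong (reverse wz) (sym ez)))
           (trans (act-cong wy (act-reverse root wz)) ey))
    }

module _ (M N : Map) where
  open GroupMorphisms (Mon M) (Mon N)
  private
    module M = Map M
    module N = Map N

  Congruent : Set
  Congruent = ∃ λ (ψ : Word → Word) →
    IsGroupIsomorphism ψ × (∀ (g : Gen) → _≈ᴹ_ N (ψ [ g ]) [ g ])

  record Morphism : Set where
    field
      ψ          : Word → Word
      ψ-hom      : IsGroupHomomorphism ψ
      ψ-surj     : FD.Surjective (_≈ᴹ_ M) (_≈ᴹ_ N) ψ
      ψ∘f≡f      : ∀ (g : Gen) → _≈ᴹ_ N (ψ [ g ]) [ g ]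
      φ          : M.Flag → N.Flag
      φ-cong     : ∀ {x y} → x M.≈ y → φ x N.≈ φ y
      φ-surj     : ∀ y → ∃ λ x → φ x N.≈ y
      φ-root     : φ M.root N.≈ N.root
      φ-equivariant : ∀ z (w : Word) → φ (_·_ M z w) N.≈ _·_ N (φ z) (ψ w)

  -- M is a cover of N
  Covers : Set
  Covers = Morphism

module _ (M₁ M₂ : Map) where
  private
    module M₁ = Map M₁
    module M₂ = Map M₂

  InOrbit : M₁.Flag × M₂.Flag → Set
  InOrbit (z₁ , z₂) =
    ∃ λ (w : Word) → (act M₁.gen M₁.root w M₁.≈ z₁) × (act M₂.gen M₂.root w M₂.≈ z₂)

  X : Set
  X = Σ (M₁.Flag × M₂.Flag) InOrbit

  genX : Gen → X → X
  genX g ((z₁ , z₂) , (w , e₁ , e₂)) =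
    (M₁.gen g z₁ , M₂.gen g z₂) ,
    (w ++ [ g ]) ,
    P.subst (M₁._≈ M₁.gen g z₁) (P.sym (act-++ M₁.gen M₁.root w [ g ])) (M₁.gen-cong g e₁) ,
    P.subst (M₂._≈ M₂.gen g z₂) (P.sym (act-++ M₂.gen M₂.root w [ g ])) (M₂.gen-cong g e₂)

  rootX : X
  rootX = (M₁.root , M₂.root) , [] , M₁.refl , M₂.refl

  _≈X_ : X → X → Set
  ((x₁ , x₂) , _) ≈X ((y₁ , y₂) , _) = (x₁ M₁.≈ y₁) × (x₂ M₂.≈ y₂)

  XSetoid : Setoid 0ℓ 0ℓ
  XSetoid = record
    { Carrier = X
    ; _≈_ = _≈X_
    ; isEquivalence = record
      { refl  = M₁.refl , M₂.refl
      ; sym   = λ (a , b) → M₁.sym a , M₂.sym b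
      ; trans = λ (a , b) (c , d) → M₁.trans a c , M₂.trans b d
      }
    }

  actX-proj : ∀ (x : X) (w : Word) →
    proj₁ (act genX x w) ≡ (act M₁.gen (proj₁ (proj₁ x)) w , act M₂.gen (proj₂ (proj₁ x)) w)
  actX-proj x []      = P.refl
  actX-proj x (g ∷ w) = actX-proj (genX g x) w

  _∥_ : Map
  _∥_ = record
    { Flags = XSetoid
    ; gen = genX
    ; gen-cong = λ g (a , b) → M₁.gen-cong g a , M₂.gen-cong g b
    ; T²  = λ z → M₁.T² _ , M₂.T² _
    ; L²  = λ z → M₁.L² _ , M₂.L² _
    ; R²  = λ z → M₁.R² _ , M₂.R² _
    ; TL² = λ z → M₁.TL² _ , M₂.TL² _
    ; root = rootX
    ; transitive = λ { ((z₁ , z₂) , (w , e₁ , e₂)) → w , lemma w e₁ e₂ }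
    }
    where
    lemma : ∀ {z₁ z₂} w (e₁ : act M₁.gen M₁.root w M₁.≈ z₁)
                        (e₂ : act M₂.gen M₂.root w M₂.≈ z₂) →
            act genX rootX w ≈X ((z₁ , z₂) , (w , e₁ , e₂))
    lemma w e₁ e₂ with act genX rootX w | actX-proj rootX w
    ... | (a , b) , _ | P.refl = e₁ , e₂

reflexibleClosure : Map → Map
reflexibleClosure M =
  ((reroot M (act gen root [])  ∥ reroot M (act gen root (t ∷ [])))
                                ∥ reroot M (act gen root (l ∷ [])))
                                ∥ reroot M (act gen root (t ∷ l ∷ []))
  where open Map M

{-# OPTIONS --safe #-}
-- A map is reflexible iff Mon acts regularly on the flags, i.e. only the
-- identity of Mon fixes the root; and a regular map C covers every map N
-- for which there is an epimorphism ψ : Mon(C) → Mon(N) respecting the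
-- generators, via root_C · w ↦ root_N · ψ(w).
--
-- The factors of N are M with other roots, so a word acts trivially on N
-- iff it does on M: Mon(N) = Mon(M), with the same generators. A word fixing
-- the root of N fixes the four flags id·W of the root edge of M. Every flag
-- of M is the image of one of these under an automorphism (edge-
-- transitivity, and ⟨T, L⟩ has at most four elements), and automorphisms
-- commute with Mon, so the word is trivial in Mon(M) = Mon(N). Hence N is
-- regular, so reflexible, and covers M; a reflexible cover C of M is regular
-- and Mon(C) → Mon(M) = Mon(N), so C covers N.
module Submission where

open import Defs
open import Data.Product using (_×_; _,_; proj₁; proj₂; ∃; ∃₂)
open import Data.List using (List; []; _∷_; _++_; [_]; reverse; foldl)
open import Data.List.Relation.Unary.All using (All; []; _∷_)
open import Data.List.Properties using (reverse-involutive)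
open import Function.Base using (id; _∘_)
import Function.Construct.Composition as FunctionComposition
import Function.Definitions as FD
open import Relation.Binary.PropositionalEquality as ≡ using (_≡_)
import Relation.Binary.Reasoning.Setoid as SetoidReasoning
open import Algebra.Morphism.Structures using (module GroupMorphisms)
import Algebra.Morphism.Construct.Composition as HomComposition

module Action (M : Map) where
  open Map M public
  open SetoidReasoning Flags public

  infixl 5 _∙_
  infix 4 _≃_

  _∙_ : Flag → Word → Flag
  _∙_ = _·_ M

  _≃_ : Word → Word → Set
  _≃_ = _≈ᴹ_ M

  ≃-trans : ∀ {u v w} → u ≃ v → v ≃ w → u ≃ w
  ≃-trans p q z = trans (p z) (q z)

  ∙-++ : ∀ z u v → z ∙ (u ++ v) ≈ z ∙ u ∙ v
  ∙-++ z u v = reflexive (act-++ gen z u v)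

  ∙-cong : ∀ {x y} w → x ≈ y → x ∙ w ≈ y ∙ w
  ∙-cong = act-cong M

  ∙-reverse : ∀ z q → z ∙ q ∙ reverse q ≈ z
  ∙-reverse = act-reverse M

  ∙-reverse˘ : ∀ z q → z ∙ reverse q ∙ q ≈ z
  ∙-reverse˘ z q =
    ≡.subst (λ q′ → z ∙ reverse q ∙ q′ ≈ z) (reverse-involutive q) (∙-reverse z (reverse q))

  pathTo : Flag → Word
  pathTo z = proj₁ (transitive z)

  root∙pathTo : ∀ z → root ∙ pathTo z ≈ z
  root∙pathTo z = proj₂ (transitive z)

  root∙pathTo++ : ∀ z w → root ∙ (pathTo z ++ w) ≈ z ∙ w
  root∙pathTo++ z w = trans (∙-++ root (pathTo z) w) (∙-cong w (root∙pathTo z))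

SameAtRoot : Map → Word → Word → Set
SameAtRoot M u u′ = root ∙ u ≈ root ∙ u′
  where open Action M

IsMonRegular : Map → Set
IsMonRegular M = ∀ u u′ → SameAtRoot M u u′ → _≈ᴹ_ M u u′

module _ (M : Map) where
  open Action M

  automorphism-rigid : (a : Automorphism M) → ∀ z → Automorphism.α a z ≈ z →
                       ∀ x → Automorphism.α a x ≈ x
  automorphism-rigid a z αz≈z x = begin
    α x                          ≈⟨ α-cong (root∙pathTo x) ⟨
    α (root ∙ pathTo x)          ≈⟨ commute root (pathTo x) ⟩
    α root ∙ pathTo x            ≈⟨ ∙-cong (pathTo x) α-root ⟩
    root ∙ pathTo x              ≈⟨ root∙pathTo x ⟩
    x                            ∎
    where
    open Automorphism a
    p = pathTo z
    α-root : α root ≈ root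
    α-root = begin
      α root                     ≈⟨ ∙-reverse (α root) p ⟨
      α root ∙ p ∙ reverse p     ≈⟨ ∙-cong (reverse p) (commute root p) ⟨
      α (root ∙ p) ∙ reverse p   ≈⟨ ∙-cong (reverse p) (α-cong (root∙pathTo z)) ⟩
      α z ∙ reverse p            ≈⟨ ∙-cong (reverse p) (trans αz≈z (sym (root∙pathTo z))) ⟩
      root ∙ p ∙ reverse p       ≈⟨ ∙-reverse root p ⟩
      root                       ∎

  reflexible⇒monRegular : IsReflexible M → IsMonRegular M
  reflexible⇒monRegular (aut-transitive , _) u u′ e z = begin
    z ∙ u          ≈⟨ ∙-cong u αroot≈z ⟨
    α root ∙ u     ≈⟨ commute root u ⟨
    α (root ∙ u)   ≈⟨ α-cong e ⟩
    α (root ∙ u′)  ≈⟨ commute root u′ ⟩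
    α root ∙ u′    ≈⟨ ∙-cong u′ αroot≈z ⟩
    z ∙ u′         ∎
    where
    open Automorphism (proj₁ (aut-transitive root z))
    αroot≈z = proj₂ (aut-transitive root z)

module MonRegular (M : Map) (regular : IsMonRegular M) where
  open Action M

  free : ∀ y u u′ → y ∙ u ≈ y ∙ u′ → u ≃ u′
  free y u u′ e z = begin
    z ∙ u                          ≈⟨ ∙-cong u (∙-reverse˘ z p) ⟨
    z ∙ reverse p ∙ p ∙ u          ≈⟨ ∙-++ _ p u ⟨
    z ∙ reverse p ∙ (p ++ u)       ≈⟨ regular (p ++ u) (p ++ u′) root∙p∙u≈root∙p∙u′ (z ∙ reverse p) ⟩
    z ∙ reverse p ∙ (p ++ u′)      ≈⟨ ∙-++ _ p u′ ⟩
    z ∙ reverse p ∙ p ∙ u′         ≈⟨ ∙-cong u′ (∙-reverse˘ z p) ⟩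
    z ∙ u′                         ∎
    where
    p = pathTo y
    root∙p∙u≈root∙p∙u′ : root ∙ (p ++ u) ≈ root ∙ (p ++ u′)
    root∙p∙u≈root∙p∙u′ = trans (root∙pathTo++ y u) (trans e (sym (root∙pathTo++ y u′)))

  pathTo-unique : ∀ u {z} → root ∙ u ≈ z → pathTo z ≃ u
  pathTo-unique u {z} e = regular (pathTo z) u (trans (root∙pathTo z) (sym e))

  translation : Flag → Automorphism M
  translation a = record
    { α          = λ y → a ∙ pathTo y
    ; α-cong     = λ {x} {y} x≈y → pathTo-unique (pathTo y) (trans (root∙pathTo y) (sym x≈y)) a
    ; injective  = λ {x} {y} e → begin
        x                 ≈⟨ root∙pathTo x ⟨
        root ∙ pathTo x   ≈⟨ free a (pathTo x) (pathTo y) e root ⟩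
        root ∙ pathTo y   ≈⟨ root∙pathTo y ⟩
        y                 ∎
    ; surjective = λ y → root ∙ (reverse (pathTo a) ++ pathTo y) , hits y
    ; commute    = λ z w → trans (pathTo-unique (pathTo z ++ w) (root∙pathTo++ z w) a)
                                 (∙-++ a (pathTo z) w)
    }
    where
    p = pathTo a
    hits : ∀ y → a ∙ pathTo (root ∙ (reverse p ++ pathTo y)) ≈ y
    hits y = begin
      a ∙ pathTo (root ∙ (reverse p ++ pathTo y))  ≈⟨ pathTo-unique (reverse p ++ pathTo y) refl a ⟩
      a ∙ (reverse p ++ pathTo y)                  ≈⟨ ∙-++ a (reverse p) (pathTo y) ⟩
      a ∙ reverse p ∙ pathTo y                     ≈⟨ ∙-cong (pathTo y) (∙-cong (reverse p) (root∙pathTo a)) ⟨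
      root ∙ p ∙ reverse p ∙ pathTo y              ≈⟨ ∙-cong (pathTo y) (∙-reverse root p) ⟩
      root ∙ pathTo y                              ≈⟨ root∙pathTo y ⟩
      y                                            ∎

monRegular⇒reflexible : (M : Map) → IsMonRegular M → IsReflexible M
monRegular⇒reflexible M regular = aut-transitive , automorphism-rigid M
  where
  open Action M
  open MonRegular M regular
  aut-transitive : ∀ z z′ → ∃ λ a → Automorphism.α a z ≈ z′
  aut-transitive z z′ = translation (z′ ∙ reverse (pathTo z)) , ∙-reverse˘ z′ (pathTo z)

-- ⟨T, L⟩ is a quotient of the Klein four-group; word W is the paper's W ∈ {1, T, L, TL}.
data V₄ : Set where
  I T L TL : V₄

word : V₄ → Word
word I  = []
word T  = t ∷ []
word L  = l ∷ []
word TL = t ∷ l ∷ []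

_◂_ : EdgeGen → V₄ → V₄
et ◂ I  = T
et ◂ T  = I
et ◂ L  = TL
et ◂ TL = L
el ◂ I  = L
el ◂ T  = TL
el ◂ L  = I
el ◂ TL = T

module _ (M : Map) where
  open Action M

  lt≃tl : l ∷ t ∷ [] ≃ t ∷ l ∷ []
  lt≃tl y = trans (sym (TL² (gen t (gen l y))))
                  (gen-cong l (gen-cong t (trans (gen-cong l (T² (gen l y))) (L² y))))

  ◂-word : ∀ g W → embE g ∷ word W ≃ word (g ◂ W)
  ◂-word et I  y = refl
  ◂-word et T  y = T² y
  ◂-word et L  y = refl
  ◂-word et TL y = gen-cong l (T² y)
  ◂-word el I  y = refl
  ◂-word el T  y = lt≃tl y
  ◂-word el L  y = L² y
  ◂-word el TL y = trans (gen-cong l (lt≃tl y)) (L² (gen t y))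

  edgeWord-V₄ : ∀ e → ∃ λ W → embW e ≃ word W
  edgeWord-V₄ []      = I , λ y → refl
  edgeWord-V₄ (g ∷ e) with edgeWord-V₄ e
  ... | W , e≃W = g ◂ W , λ y → trans (e≃W (gen (embE g) y)) (◂-word g W y)

  Aut-orbits-meet-rootEdge : IsEdgeTransitive M →
    ∀ z → ∃₂ λ (a : Automorphism M) W → Automorphism.α a (root ∙ word W) ≈ z
  Aut-orbits-meet-rootEdge edge-transitive z with edge-transitive root z
  ... | a , e , αroot∙e≈z with edgeWord-V₄ e
  ...   | W , e≃W = a , W , trans (commute root (word W)) (trans (sym (e≃W (α root))) αroot∙e≈z)
    where open Automorphism a

  rootEdge-faithful : IsEdgeTransitive M →
    ∀ u u′ → (∀ W → root ∙ word W ∙ u ≈ root ∙ word W ∙ u′) → u ≃ u′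
  rootEdge-faithful edge-transitive u u′ agree z
    with Aut-orbits-meet-rootEdge edge-transitive z
  ... | a , W , αx≈z = begin
    z ∙ u               ≈⟨ ∙-cong u αx≈z ⟨
    α x ∙ u             ≈⟨ commute x u ⟨
    α (x ∙ u)           ≈⟨ α-cong (agree W) ⟩
    α (x ∙ u′)          ≈⟨ commute x u′ ⟩
    α x ∙ u′            ≈⟨ ∙-cong u′ αx≈z ⟩
    z ∙ u′              ∎
    where
    open Automorphism a
    x = root ∙ word W

record MonEpimorphism (A B : Map) : Set where
  field
    ψ      : Word → Word
    ψ-hom  : GroupMorphisms.IsGroupHomomorphism (Mon A) (Mon B) ψ
    ψ-surj : FD.Surjective (_≈ᴹ_ A) (_≈ᴹ_ B) ψ
    ψ∘f≡f  : ∀ g → _≈ᴹ_ B (ψ [ g ]) [ g ]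

monEpimorphism : ∀ {A B} → Covers A B → MonEpimorphism A B
monEpimorphism mor = record { Morphism mor }

_⊆ᴹ_ : Map → Map → Set
A ⊆ᴹ B = ∀ u u′ → _≈ᴹ_ A u u′ → _≈ᴹ_ B u u′

module _ {A B : Map} where
  private module B = Action B
  open GroupMorphisms (Mon A) (Mon B)

  Mon-id-isGroupHomomorphism : A ⊆ᴹ B → IsGroupHomomorphism id
  Mon-id-isGroupHomomorphism A⊆B = record
    { isMonoidHomomorphism = record
      { isMagmaHomomorphism = record
        { isRelHomomorphism = record { cong = λ {u} {u′} → A⊆B u u′ }
        ; homo = λ _ _ _ → B.refl }
      ; ε-homo = λ _ → B.refl }
    ; ⁻¹-homo = λ _ _ → B.refl }

  Mon-id-isGroupIsomorphism : A ⊆ᴹ B → B ⊆ᴹ A → IsGroupIsomorphism id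
  Mon-id-isGroupIsomorphism A⊆B B⊆A = record
    { isGroupMonomorphism = record
      { isGroupHomomorphism = Mon-id-isGroupHomomorphism A⊆B
      ; injective = λ {u} {u′} → B⊆A u u′ }
    ; surjective = λ y → y , λ {u} → A⊆B u y }

  ⊆ᴹ⇒monEpimorphism : A ⊆ᴹ B → MonEpimorphism A B
  ⊆ᴹ⇒monEpimorphism A⊆B = record
    { ψ      = id
    ; ψ-hom  = Mon-id-isGroupHomomorphism A⊆B
    ; ψ-surj = λ y → y , λ {u} → A⊆B u y
    ; ψ∘f≡f  = λ _ _ → B.refl }

_⨾_ : ∀ {A B C} → MonEpimorphism A B → MonEpimorphism B C → MonEpimorphism A C
_⨾_ {A} {B} {C} f g = record
  { ψ      = λ w → G.ψ (F.ψ w)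
  ; ψ-hom  = HomComposition.isGroupHomomorphism (λ {u v w} → C.≃-trans {u} {v} {w}) {f = F.ψ} {g = G.ψ}
               F.ψ-hom G.ψ-hom
  ; ψ-surj = FunctionComposition.surjective (_≈ᴹ_ A) (_≈ᴹ_ B) (_≈ᴹ_ C) {f = F.ψ} {g = G.ψ}
               F.ψ-surj G.ψ-surj
  ; ψ∘f≡f  = λ g z → C.trans (G.⟦⟧-cong {F.ψ [ g ]} {[ g ]} (F.ψ∘f≡f g) z) (G.ψ∘f≡f g z) }
  where
  module C = Action C
  module F = MonEpimorphism f
  module G where
    open MonEpimorphism g public
    open GroupMorphisms.IsGroupHomomorphism ψ-hom public using (⟦⟧-cong)

monRegular-covers : (C N : Map) → IsMonRegular C → MonEpimorphism C N → Covers C N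
monRegular-covers C N regular epi = record
  { MonEpimorphism epi
  ; φ             = φ
  ; φ-cong        = λ {x} {y} x≈y → ψ-pathTo (C.pathTo y) (C.trans (C.root∙pathTo y) (C.sym x≈y)) N.root
  ; φ-surj        = φ-surj
  ; φ-root        = N.trans (ψ-pathTo [] C.refl N.root) (ψ.ε-homo N.root)
  ; φ-equivariant = φ-equivariant
  }
  where
  module C = Action C
  module N = Action N
  open MonRegular C regular
  open MonEpimorphism epi
  module ψ = GroupMorphisms.IsGroupHomomorphism ψ-hom

  φ : C.Flag → N.Flag
  φ c = N.root N.∙ ψ (C.pathTo c)

  ψ-pathTo : ∀ u {c} → C.root C.∙ u C.≈ c → ψ (C.pathTo c) N.≃ ψ u
  ψ-pathTo u e = ψ.⟦⟧-cong (pathTo-unique u e)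

  φ-surj : ∀ y → ∃ λ x → φ x N.≈ y
  φ-surj y with ψ-surj (N.pathTo y)
  ... | s , ψ≃ = C.root C.∙ s , N.trans (ψ≃ (pathTo-unique s C.refl) N.root) (N.root∙pathTo y)

  φ-equivariant : ∀ z w → φ (z C.∙ w) N.≈ φ z N.∙ ψ w
  φ-equivariant z w = begin
    N.root N.∙ ψ (C.pathTo (z C.∙ w))          ≈⟨ ψ-pathTo (C.pathTo z ++ w) (C.root∙pathTo++ z w) N.root ⟩
    N.root N.∙ ψ (C.pathTo z ++ w)             ≈⟨ ψ.homo (C.pathTo z) w N.root ⟩
    N.root N.∙ (ψ (C.pathTo z) ++ ψ w)         ≈⟨ N.∙-++ N.root (ψ (C.pathTo z)) (ψ w) ⟩
    N.root N.∙ ψ (C.pathTo z) N.∙ ψ w          ∎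
    where open N using (begin_; step-≈-⟩; _∎)

module _ (M₁ M₂ : Map) where
  private
    module M₁ = Action M₁
    module M₂ = Action M₂
    module P = Action (M₁ ∥ M₂)

    fst : P.Flag → M₁.Flag
    fst x = proj₁ (proj₁ x)

    snd : P.Flag → M₂.Flag
    snd x = proj₂ (proj₁ x)

    fst-∙ : ∀ x w → fst (x P.∙ w) ≡ fst x M₁.∙ w
    fst-∙ x w = ≡.cong proj₁ (actX-proj M₁ M₂ x w)

    snd-∙ : ∀ x w → snd (x P.∙ w) ≡ snd x M₂.∙ w
    snd-∙ x w = ≡.cong proj₂ (actX-proj M₁ M₂ x w)

  ∥-sameAtRoot : ∀ u u′ → SameAtRoot (M₁ ∥ M₂) u u′ → SameAtRoot M₁ u u′ × SameAtRoot M₂ u u′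
  ∥-sameAtRoot u u′ (e₁ , e₂) =
    ≡.subst₂ M₁._≈_ (fst-∙ P.root u) (fst-∙ P.root u′) e₁ ,
    ≡.subst₂ M₂._≈_ (snd-∙ P.root u) (snd-∙ P.root u′) e₂

  ⊆ᴹ-∥ : ∀ C → C ⊆ᴹ M₁ → C ⊆ᴹ M₂ → C ⊆ᴹ (M₁ ∥ M₂)
  ⊆ᴹ-∥ C C⊆M₁ C⊆M₂ u u′ h x =
    ≡.subst₂ M₁._≈_ (≡.sym (fst-∙ x u)) (≡.sym (fst-∙ x u′)) (C⊆M₁ u u′ h (fst x)) ,
    ≡.subst₂ M₂._≈_ (≡.sym (snd-∙ x u)) (≡.sym (snd-∙ x u′)) (C⊆M₂ u u′ h (snd x))

  ∥-⊆ᴹ-left : (M₁ ∥ M₂) ⊆ᴹ M₁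
  ∥-⊆ᴹ-left u u′ h z = begin
    z ∙ u                        ≈⟨ M₁.∙-cong u (M₁.root∙pathTo z) ⟨
    M₁.root ∙ p ∙ u              ≡⟨ ≡.cong (_∙ u) (fst-∙ P.root p) ⟨
    fst (P.root P.∙ p) ∙ u       ≡⟨ fst-∙ (P.root P.∙ p) u ⟨
    fst (P.root P.∙ p P.∙ u)     ≈⟨ proj₁ (h (P.root P.∙ p)) ⟩
    fst (P.root P.∙ p P.∙ u′)    ≡⟨ fst-∙ (P.root P.∙ p) u′ ⟩
    fst (P.root P.∙ p) ∙ u′      ≡⟨ ≡.cong (_∙ u′) (fst-∙ P.root p) ⟩
    M₁.root ∙ p ∙ u′             ≈⟨ M₁.∙-cong u′ (M₁.root∙pathTo z) ⟩
    z ∙ u′                       ∎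
    where
    open M₁ using (_∙_; begin_; step-≈-⟩; step-≈-⟨; step-≡-⟩; step-≡-⟨; _∎)
    p = M₁.pathTo z

⨂ : Map → List Map → Map
⨂ = foldl _∥_

⨂-⊆ᴹ-head : ∀ A Bs → ⨂ A Bs ⊆ᴹ A
⨂-⊆ᴹ-head A []       u u′ = id
⨂-⊆ᴹ-head A (B ∷ Bs) u u′ = ∥-⊆ᴹ-left A B u u′ ∘ ⨂-⊆ᴹ-head (A ∥ B) Bs u u′

⊆ᴹ-⨂ : ∀ C A Bs → C ⊆ᴹ A → All (C ⊆ᴹ_) Bs → C ⊆ᴹ ⨂ A Bs
⊆ᴹ-⨂ C A []       C⊆A []           = C⊆A
⊆ᴹ-⨂ C A (B ∷ Bs) C⊆A (C⊆B ∷ C⊆Bs) = ⊆ᴹ-⨂ C (A ∥ B) Bs (⊆ᴹ-∥ A B C C⊆A C⊆B) C⊆Bs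

⨂-sameAtRoot : ∀ A Bs u u′ → SameAtRoot (⨂ A Bs) u u′ →
               SameAtRoot A u u′ × All (λ B → SameAtRoot B u u′) Bs
⨂-sameAtRoot A []       u u′ e = e , []
⨂-sameAtRoot A (B ∷ Bs) u u′ e =
  let (eAB , eBs) = ⨂-sameAtRoot (A ∥ B) Bs u u′ e
      (eA , eB)   = ∥-sameAtRoot A B u u′ eAB
  in eA , eB ∷ eBs

module _ (M : Map) where
  open Action M

  -- Spelled exactly as in reflexibleClosure, so that reflexibleClosure M and
  -- ⨂ (reroot M (act gen root [])) rerootings are syntactically equal after
  -- unfolding; any other spelling makes conversion checking blow up.
  rerootings : List Map
  rerootings = reroot M (act gen root (t ∷ [])) ∷ reroot M (act gen root (l ∷ []))
             ∷ reroot M (act gen root (t ∷ l ∷ [])) ∷ []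

  reflexibleClosure-⊆ᴹ : reflexibleClosure M ⊆ᴹ M
  reflexibleClosure-⊆ᴹ = ⨂-⊆ᴹ-head (reroot M (act gen root [])) rerootings

  ⊆ᴹ-reflexibleClosure : M ⊆ᴹ reflexibleClosure M
  ⊆ᴹ-reflexibleClosure =
    ⊆ᴹ-⨂ M (reroot M (act gen root [])) rerootings ⊆ᴹ-refl (⊆ᴹ-refl ∷ ⊆ᴹ-refl ∷ ⊆ᴹ-refl ∷ [])
    where
    -- a re-rooting has literally the same monodromy action as M
    ⊆ᴹ-refl : M ⊆ᴹ M
    ⊆ᴹ-refl _ _ = id

  reflexibleClosure-sameAtRoot : ∀ u u′ → SameAtRoot (reflexibleClosure M) u u′ →
                                 ∀ W → root ∙ word W ∙ u ≈ root ∙ word W ∙ u′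
  reflexibleClosure-sameAtRoot u u′ e
    with ⨂-sameAtRoot (reroot M (act gen root [])) rerootings u u′ e
  ... | e-I , e-T ∷ e-L ∷ e-TL ∷ [] = λ { I → e-I ; T → e-T ; L → e-L ; TL → e-TL }

  reflexibleClosure-monRegular : IsEdgeTransitive M → IsMonRegular (reflexibleClosure M)
  reflexibleClosure-monRegular edge-transitive u u′ e =
    ⊆ᴹ-reflexibleClosure u u′
      (rootEdge-faithful M edge-transitive u u′ (reflexibleClosure-sameAtRoot u u′ e))

corollary21 : (M : Map) → IsFinite M → IsEdgeTransitive M →
    IsReflexible (reflexibleClosure M)
    × Congruent (reflexibleClosure M) M
    × Covers (reflexibleClosure M) M
    × ((C : Map) → IsFinite C → IsReflexible C → Covers C M → Covers C (reflexibleClosure M))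
corollary21 M _ edge-transitive =
    monRegular⇒reflexible N N-monRegular
  , (id , Mon-id-isGroupIsomorphism {N} {M} N⊆M M⊆N , λ _ _ → Map.refl M)
  , monRegular-covers N M N-monRegular (⊆ᴹ⇒monEpimorphism {N} {M} N⊆M)
  , λ C _ C-reflexible C→M →
      monRegular-covers C N (reflexible⇒monRegular C C-reflexible)
                        (monEpimorphism C→M ⨾ ⊆ᴹ⇒monEpimorphism {M} {N} M⊆N)
  where
  N = reflexibleClosure M
  N-monRegular = reflexibleClosure-monRegular M edge-transitive
  N⊆M = reflexibleClosure-⊆ᴹ M
  M⊆N = ⊆ᴹ-reflexibleClosure M
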